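{- Let $\alpha\in\{+,-\}$. A bidirected graph $G$ with a vertex $r\in V(G)$ is a strong $\alpha$-radial with root $r$ if and only if $G$ is an absolute semiradial with root $r$ that has a $(-\alpha,-\alpha)$-ditrail closed over $r$.
   Context: A bidirected graph $G$ is a finite graph (loops and parallel edges allowed) with maps $\partial_+,\partial_-:E(G)\to 2^{V(G)}$ such that for each edge $e$ with (possibly identical) ends $u,v$: $\partial_\alpha(e)\subseteq\{u,v\}$, $\partial_+(e)\cup\partial_-(e)=\{u,v\}$, and $\partial_+(e)\cap\partial_-(e)=\emptyset$ if $e$ is not a loop. If $u\in\partial_\alpha(e)$, the sign of $u$ over $e$ is $\alpha$; $-\alpha$ denotes the opposite sign. A walk is a sequence $W=(w_1,\dots,w_k)$, $k$ odd, with $w_i$ a vertex for odd $i$ and $w_i$ an edge joining $w_{i-1},w_{i+1}$ for even $i$; closed over $r$ if $w_1=w_k=r$; a trail has no repeated edge. $W$ is a diwalk if to each traversal of an edge $w_i$ one can assign signs to its end-occurrences equal to the signs of these vertices over $w_i$ (for a loop with one end $+$ and one end $-$, the two assigned signs are distinct), such that at every internal vertex term the signs assigned from the preceding and following edges are distinct. A ditrail is a diwalk that is a trail. For $k\ge3$ the sign of $w_1$ (resp. $w_k$) over $W$ is the sign assigned at $w_2$ (resp. $w_{k-1}$); $W$ is an $(\alpha,\beta)$-ditrail if these are $\alpha,\beta$, and an $\alpha$-ditrail if it is an $(\alpha,\beta)$-ditrail for some $\beta$; the trivial ditrail $(v)$ counts as both a $(+,-)$- and a $(-,+)$-ditrail.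 $G$ is an $\alpha$-radial with root $r$ if every $v\in V(G)$ has an $(\alpha,-\alpha)$-ditrail from $v$ to $r$; an $\alpha$-semiradial with root $r$ if every $v$ has an $\alpha$-ditrail from $v$ to $r$; an absolute semiradial with root $r$ if it is an $\alpha$-semiradial with root $r$ for both $\alpha$. An $\alpha$-radial $G$ with root $r$ is strong if every $v\in V(G)$ has a $(-\alpha,-\alpha)$-ditrail from $v$ to $r$. -}

module Defs where

open import Data.Nat using (ℕ)
open import Data.Fin using (Fin)
open import Data.Fin.Subset using (Subset; _∈_)
open import Data.Product using (Σ; _×_; _,_; proj₁; proj₂)
open import Data.Sum using (_⊎_)
open import Data.Empty using (⊥)
open import Data.List using (List; []; _∷_; map)
open import Data.List.Relation.Unary.Unique.Propositional using (Unique)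
open import Relation.Binary.PropositionalEquality using (_≡_; _≢_)

data Sign : Set where
  plus minus : Sign

neg : Sign → Sign
neg plus  = minus
neg minus = plus

record BiGraph : Set where
  field
    nV nE : ℕ
    ends  : Fin nE → Fin nV × Fin nV
    ∂     : Sign → Fin nE → Subset nV
    ∂-sub   : ∀ α e x → x ∈ ∂ α e →
              x ≡ proj₁ (ends e) ⊎ x ≡ proj₂ (ends e)
    ∂-cover : ∀ e x → (x ≡ proj₁ (ends e) ⊎ x ≡ proj₂ (ends e)) →
              x ∈ ∂ plus e ⊎ x ∈ ∂ minus e
    ∂-disj  : ∀ e → proj₁ (ends e) ≢ proj₂ (ends e) →
              ∀ x → x ∈ ∂ plus e → x ∈ ∂ minus e → ⊥

open BiGraph public

module _ (G : BiGraph) where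

  V = Fin (nV G)
  E = Fin (nE G)

  Joins : E → V → V → Set
  Joins e x y = ends G e ≡ (x , y) ⊎ ends G e ≡ (y , x)

  MixedLoop : E → Set
  MixedLoop e = proj₁ (ends G e) ≡ proj₂ (ends G e)
              × proj₁ (ends G e) ∈ ∂ G plus e
              × proj₁ (ends G e) ∈ ∂ G minus e

  Traversal : E → V → V → Sign → Sign → Set
  Traversal e x y σ τ = Joins e x y × x ∈ ∂ G σ e × y ∈ ∂ G τ e
                      × (MixedLoop e → σ ≢ τ)

  -- A walk (w₁,…,w_k) is given by its first vertex and the list of
  -- (edge, next vertex) pairs.
  data NTDiWalk : V → List (E × V) → V → Sign → Sign → Set where
    one  : ∀ {x e y α β} → Traversal e x y α β →
           NTDiWalk x ((e , y) ∷ []) y α β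
    more : ∀ {x e y s z α σ β} → Traversal e x y α σ →
           NTDiWalk y s z (neg σ) β →
           NTDiWalk x ((e , y) ∷ s) z α β

  data DiWalk : V → List (E × V) → V → Sign → Sign → Set where
    trivial₁ : ∀ {x} → DiWalk x [] x plus minus
    trivial₂ : ∀ {x} → DiWalk x [] x minus plus
    nontriv  : ∀ {x s y α β} → NTDiWalk x s y α β → DiWalk x s y α β

  DiTrail : V → V → Sign → Sign → Set
  DiTrail x y α β = Σ (List (E × V)) λ s →
                      DiWalk x s y α β × Unique (map proj₁ s)

  Radial : Sign → V → Set
  Radial α r = ∀ v → DiTrail v r α (neg α)

  Semiradial : Sign → V → Set
  Semiradial α r = ∀ v → Σ Sign λ β → DiTrail v r α β

  AbsoluteSemiradial : V → Set
  AbsoluteSemiradial r = ∀ α → Semiradial α r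

  StrongRadial : Sign → V → Set
  StrongRadial α r = Radial α r × (∀ v → DiTrail v r (neg α) (neg α))

-- One direction is immediate: the ditrails of a strong α-radial from v to r
-- are α-ditrails and (-α)-ditrails, and the one from r itself is closed.
--
-- The converse rests on a rerouting lemma.  Let C be a (γ,γ)-ditrail closed
-- over r.  Any σ-ditrail P from x to r can be turned into a (σ,γ)-ditrail
-- from x to r: follow P until it first meets a vertex v of C, then finish
-- inside C.  If v cuts C into C₁ (from r to v) and C₂ (from v to r), one of
-- C₂ or the reversal of C₁ leaves v with the sign that P needs, and both
-- arrive at r with sign γ.  The prefix of P avoids the edges of C because
-- its vertices before v are off C, so the result is again a trail.
-- With γ = -α, rerouting the α- and (-α)-ditrails of an absolute
-- semiradial gives exactly the two families of a strong α-radial.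
module Submission where

open import Defs
open import Data.Product using (_×_; _,_; proj₁; proj₂)
open import Data.Sum using (_⊎_; inj₁; inj₂)
open import Data.Fin using (_≟_)
open import Data.List using (List; []; _∷_; _++_; [_]; map)
open import Data.List.Properties using (map-++)
open import Data.List.Membership.Propositional using (_∈_; _∉_)
open import Data.List.Membership.Propositional.Properties using (∈-++⁺ˡ; ∈-++⁺ʳ; ∈-++⁻)
open import Data.List.Relation.Unary.Any using (here; there; any?)
open import Data.List.Relation.Unary.All.Properties using (++⁻ˡ; ¬Any⇒All¬; All¬⇒¬Any)
open import Data.List.Relation.Unary.AllPairs using ([]; _∷_)
open import Data.List.Relation.Unary.Unique.Propositional using (Unique)
open import Data.List.Relation.Binary.Subset.Propositional using (_⊆_)
open import Data.List.Relation.Binary.Permutation.Propositional using (_↭_; ↭-refl; ↭-sym; ↭⇒↭ₛ; module PermutationReasoning)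
open import Data.List.Relation.Binary.Permutation.Propositional.Properties using (∈-resp-↭; ++⁺ʳ; ∷↭∷ʳ)
import Data.List.Relation.Binary.Permutation.Setoid.Properties as SetoidPermutation
open import Relation.Binary.PropositionalEquality using (_≡_; refl; sym; trans; cong; subst; setoid)
open import Relation.Nullary using (¬_; Dec; yes; no)
open import Relation.Nullary.Decidable using (_⊎-dec_)
open import Function.Bundles using (_⇔_; mk⇔)

neg-involutive : ∀ σ → neg (neg σ) ≡ σ
neg-involutive plus  = refl
neg-involutive minus = refl

sign-cases : ∀ σ γ → σ ≡ γ ⊎ σ ≡ neg γ
sign-cases plus  plus  = inj₁ refl
sign-cases plus  minus = inj₂ refl
sign-cases minus plus  = inj₂ refl
sign-cases minus minus = inj₁ refl

Unique-++⁻ : ∀ {A : Set} (xs : List A) {ys : List A} →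
             Unique (xs ++ ys) → Unique xs × Unique ys
Unique-++⁻ []       u        = [] , u
Unique-++⁻ (x ∷ xs) (x≢ ∷ u) with Unique-++⁻ xs u
... | uxs , uys = ++⁻ˡ xs x≢ ∷ uxs , uys

Unique-resp-↭ : ∀ {A : Set} {xs ys : List A} → xs ↭ ys → Unique xs → Unique ys
Unique-resp-↭ {A} p = SetoidPermutation.Unique-resp-↭ (setoid A) (↭⇒↭ₛ p)

module Walks (G : BiGraph) where

  Steps : Set
  Steps = List (E G × V G)

  edges : Steps → List (E G)
  edges = map proj₁

  -- The vertices reached by the steps, i.e. all but the first vertex.
  visited : Steps → List (V G)
  visited = map proj₂

  edges-++ : ∀ s t → edges (s ++ t) ≡ edges s ++ edges t
  edges-++ = map-++ proj₁

  ⊆-edges-++ : ∀ s t → edges s ++ edges t ⊆ edges (s ++ t)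
  ⊆-edges-++ s t = subst (_ ∈_) (sym (edges-++ s t))

  IsEnd : E G → V G → Set
  IsEnd e x = x ≡ proj₁ (ends G e) ⊎ x ≡ proj₂ (ends G e)

  joins-sym : ∀ {e x y} → Joins G e x y → Joins G e y x
  joins-sym (inj₁ p) = inj₂ p
  joins-sym (inj₂ p) = inj₁ p

  joins-end : ∀ {e x y} → Joins G e x y → IsEnd e x
  joins-end (inj₁ p) = inj₁ (sym (cong proj₁ p))
  joins-end (inj₂ p) = inj₂ (sym (cong proj₂ p))

  joins-ends : ∀ {e x y v} → Joins G e x y → IsEnd e v → v ≡ x ⊎ v ≡ y
  joins-ends (inj₁ p) (inj₁ q) = inj₁ (trans q (cong proj₁ p))
  joins-ends (inj₁ p) (inj₂ q) = inj₂ (trans q (cong proj₂ p))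
  joins-ends (inj₂ p) (inj₁ q) = inj₂ (trans q (cong proj₁ p))
  joins-ends (inj₂ p) (inj₂ q) = inj₁ (trans q (cong proj₂ p))

  traversal-reverse : ∀ {e x y σ τ} → Traversal G e x y σ τ → Traversal G e y x τ σ
  traversal-reverse (j , x∈ , y∈ , mixed) = joins-sym j , y∈ , x∈ , λ m τ≡σ → mixed m (sym τ≡σ)

  trivial-ending : ∀ {x} γ → DiWalk G x [] x (neg γ) γ
  trivial-ending plus  = trivial₂
  trivial-ending minus = trivial₁

  equal-signs-nontrivial : ∀ {x s y γ} → DiWalk G x s y γ γ → NTDiWalk G x s y γ γ
  equal-signs-nontrivial (nontriv w) = w

  cons-traversal : ∀ {e x y σ τ t z β} → Traversal G e x y σ τ →
                   DiWalk G y t z (neg τ) β → NTDiWalk G x ((e , y) ∷ t) z σ β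
  cons-traversal {τ = plus}  tr trivial₂    = one tr
  cons-traversal {τ = minus} tr trivial₁    = one tr
  cons-traversal             tr (nontriv w) = more tr w

  concat : ∀ {x s y a b t z d} → NTDiWalk G x s y a b →
           NTDiWalk G y t z (neg b) d → NTDiWalk G x (s ++ t) z a d
  concat (one tr)    w′ = more tr w′
  concat (more tr w) w′ = more tr (concat w w′)

  reverse-steps : V G → Steps → Steps
  reverse-steps x []            = []
  reverse-steps x ((e , y) ∷ s) = reverse-steps y s ++ [ (e , x) ]

  reverse : ∀ {x s y a b} → NTDiWalk G x s y a b → NTDiWalk G y (reverse-steps x s) x b a
  reverse (one tr) = one (traversal-reverse tr)
  reverse {a = a} (more {σ = σ} tr w) =
    concat (reverse w)
      (one (subst (λ τ → Traversal G _ _ _ τ a) (sym (neg-involutive σ)) (traversal-reverse tr)))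

  edges-reverse : ∀ x s → edges (reverse-steps x s) ↭ edges s
  edges-reverse x [] = ↭-refl
  edges-reverse x ((e , y) ∷ s) = begin
    edges (reverse-steps y s ++ [ (e , x) ]) ≡⟨ edges-++ (reverse-steps y s) [ (e , x) ] ⟩
    edges (reverse-steps y s) ++ [ e ]       ↭⟨ ++⁺ʳ [ e ] (edges-reverse y s) ⟩
    edges s ++ [ e ]                         ↭⟨ ∷↭∷ʳ e (edges s) ⟨
    e ∷ edges s                              ∎
    where open PermutationReasoning

  record Cut (x : V G) (s : Steps) (y v : V G) (a b : Sign) : Set where
    constructor cut
    field
      before after : Steps
      sign-at-cut  : Sign
      glue         : s ≡ before ++ after
      first        : NTDiWalk G x before v a sign-at-cut
      second       : NTDiWalk G v after y (neg sign-at-cut) b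

  cut-at : ∀ {x s y a b v} → NTDiWalk G x s y a b → v ∈ visited s →
           v ≡ y ⊎ Cut x s y v a b
  cut-at (one tr)              (here refl) = inj₁ refl
  cut-at (more {σ = σ} tr w)   (here refl) = inj₂ (cut _ _ σ refl (one tr) w)
  cut-at (more tr w)           (there m) with cut-at w m
  ... | inj₁ v≡y                      = inj₁ v≡y
  ... | inj₂ (cut c₁ c₂ σ refl w₁ w₂) = inj₂ (cut (_ ∷ c₁) c₂ σ refl (more tr w₁) w₂)

  edge-ends-visited : ∀ {x s y a b e v} → NTDiWalk G x s y a b → e ∈ edges s →
                      IsEnd e v → v ≡ x ⊎ v ∈ visited s
  edge-ends-visited (one tr)    (here refl) v-end with joins-ends (proj₁ tr) v-end
  ... | inj₁ v≡x = inj₁ v≡x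
  ... | inj₂ v≡y = inj₂ (here v≡y)
  edge-ends-visited (more tr w) (here refl) v-end with joins-ends (proj₁ tr) v-end
  ... | inj₁ v≡x = inj₁ v≡x
  ... | inj₂ v≡y = inj₂ (here v≡y)
  edge-ends-visited (more tr w) (there m)   v-end with edge-ends-visited w m v-end
  ... | inj₁ v≡y = inj₂ (here v≡y)
  ... | inj₂ v∈  = inj₂ (there v∈)

  module Rerouting (r : V G) (γ : Sign) where

    record Route (x : V G) (σ : Sign) (allowed : List (E G)) : Set where
      constructor route
      field
        steps  : Steps
        walk   : DiWalk G x steps r σ γ
        trail  : Unique (edges steps)
        within : edges steps ⊆ allowed

    to-ditrail : ∀ {x σ allowed} → Route x σ allowed → DiTrail G x r σ γ
    to-ditrail (route s w u _) = s , w , u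

    widen : ∀ {x σ allowed} extra → Route x σ allowed → Route x σ (extra ++ allowed)
    widen extra (route s w u within) = route s w u (λ e∈ → ∈-++⁺ʳ extra (within e∈))

    route-from-root : ∀ {c} → NTDiWalk G r c r γ γ → Unique (edges c) →
                      ∀ σ → Route r σ (edges c)
    route-from-root C uc σ with sign-cases σ γ
    ... | inj₁ refl = route _ (nontriv C) uc (λ m → m)
    ... | inj₂ refl = route [] (trivial-ending γ) [] (λ ())

    -- From any vertex visited by a closed (γ,γ)-ditrail c over r, either
    -- sign reaches r inside c: by the part after the vertex, or by the
    -- reversal of the part before it.
    route-along-cycle : ∀ {c v} → NTDiWalk G r c r γ γ → Unique (edges c) →
                        v ∈ visited c → ∀ σ → Route v σ (edges c)
    route-along-cycle C uc m σ with cut-at C m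
    ... | inj₁ refl = route-from-root C uc σ
    ... | inj₂ (cut c₁ c₂ s refl w₁ w₂)
      with Unique-++⁻ (edges c₁) (subst Unique (edges-++ c₁ c₂) uc) | sign-cases σ s
    ...   | uc₁ , uc₂ | inj₁ refl =
      route (reverse-steps r c₁) (nontriv (reverse w₁))
            (Unique-resp-↭ (↭-sym (edges-reverse r c₁)) uc₁)
            (λ e∈ → ⊆-edges-++ c₁ c₂ (∈-++⁺ˡ (∈-resp-↭ (edges-reverse r c₁) e∈)))
    ...   | uc₁ , uc₂ | inj₂ refl =
      route c₂ (nontriv w₂) uc₂
            (λ e∈ → ⊆-edges-++ c₁ c₂ (∈-++⁺ʳ (edges c₁) e∈))

    module AlongCycle {c : Steps} (C : NTDiWalk G r c r γ γ) (uc : Unique (edges c)) where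

      OnCycle : V G → Set
      OnCycle x = x ≡ r ⊎ x ∈ visited c

      on-cycle? : ∀ x → Dec (OnCycle x)
      on-cycle? x = (x ≟ r) ⊎-dec any? (x ≟_) (visited c)

      route-on-cycle : ∀ {x} → OnCycle x → ∀ σ → Route x σ (edges c)
      route-on-cycle (inj₁ refl) = route-from-root C uc
      route-on-cycle (inj₂ x∈)   = route-along-cycle C uc x∈

      off-cycle-edge : ∀ {e x y σ τ} → Traversal G e x y σ τ → ¬ OnCycle x → e ∉ edges c
      off-cycle-edge tr off e∈c = off (edge-ends-visited C e∈c (joins-end (proj₁ tr)))

      prepend : ∀ {e x y σ τ q} → Traversal G e x y σ τ → ¬ OnCycle x → e ∉ edges q →
                Route y (neg τ) (edges q ++ edges c) →
                Route x σ (edges ((e , y) ∷ q) ++ edges c)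
      prepend {e} {y = y} {q = q} tr off e∉q (route t w ut within) =
        route (_ ∷ t) (nontriv (cons-traversal tr w)) (¬Any⇒All¬ (edges t) e∉t ∷ ut) within′
        where
        e∉t : e ∉ edges t
        e∉t e∈t with ∈-++⁻ (edges q) (within e∈t)
        ... | inj₁ e∈q = e∉q e∈q
        ... | inj₂ e∈c = off-cycle-edge tr off e∈c

        within′ : e ∷ edges t ⊆ edges ((e , y) ∷ q) ++ edges c
        within′ (here refl) = here refl
        within′ (there e∈t) = there (within e∈t)

      -- Follow a ditrail p to r until it meets c, then finish inside c.
      reroute-steps : ∀ {x p σ β} → NTDiWalk G x p r σ β → Unique (edges p) →
                      Route x σ (edges p ++ edges c)
      reroute-steps {x} {p} {σ} P up with on-cycle? x
      ... | yes on = widen (edges p) (route-on-cycle on σ)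
      reroute-steps (one tr)    up        | no off =
        prepend tr off (λ ()) (route-on-cycle (inj₁ refl) _)
      reroute-steps (more tr w) (e≢ ∷ up) | no off =
        prepend tr off (All¬⇒¬Any e≢) (reroute-steps w up)

      reroute : ∀ {x σ β} → DiTrail G x r σ β → DiTrail G x r σ γ
      reroute (_ , trivial₁ , _)  = to-ditrail (route-on-cycle (inj₁ refl) plus)
      reroute (_ , trivial₂ , _)  = to-ditrail (route-on-cycle (inj₁ refl) minus)
      reroute (_ , nontriv P , u) = to-ditrail (reroute-steps P u)

lemma9p3 : (α : Sign) (G : BiGraph) (r : V G) →
    StrongRadial G α r ⇔
      (AbsoluteSemiradial G r × DiTrail G r r (neg α) (neg α))
lemma9p3 α G r = mk⇔ forward backward
  where
  open Walks G

  -- The two families of ditrails of a strong radial cover both start signs.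
  forward : StrongRadial G α r → AbsoluteSemiradial G r × DiTrail G r r (neg α) (neg α)
  forward (radial , strong) = absolute , strong r
    where
    absolute : AbsoluteSemiradial G r
    absolute β v with sign-cases β α
    ... | inj₁ refl = neg α , radial v
    ... | inj₂ refl = neg α , strong v

  -- Reroute the α- and (-α)-ditrails along the closed (-α,-α)-ditrail.
  backward : AbsoluteSemiradial G r × DiTrail G r r (neg α) (neg α) → StrongRadial G α r
  backward (absolute , (c , closed , uc)) =
    (λ v → reroute (proj₂ (absolute α v))) , (λ v → reroute (proj₂ (absolute (neg α) v)))
    where open Rerouting.AlongCycle r (neg α) (equal-signs-nontrivial closed) uc
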